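{- Let $D_2$ be the digraph with vertex set $\{a,b,v_1,v_2\}$ and edge set $\{(a,v_1),(v_1,b),(a,v_2),(v_2,b)\}$. Then $D_2$ is tournament Sidorenko.
   Context: All digraphs are oriented graphs (no loops, no antiparallel edges). A tournament is an orientation of a complete graph without loops. $t_D(T)=h_D(T)/v(T)^{v(D)}$ where $h_D(T)$ is the number of maps $\phi:V(D)\to V(T)$ with $(\phi(x),\phi(y))\in E(T)$ for every $(x,y)\in E(D)$. $D$ is tournament Sidorenko if $t_D(T)\ge(1-o(1))2^{ -e(D)}$ for every tournament $T$, where $o(1)\to0$ as the number of vertices of $T$ tends to infinity. -}

module Defs where

open import Data.Nat using (ℕ; zero; suc; _^_; _≥_)
open import Data.Nat.Properties using (m^n≢0)
open import Data.Bool using (Bool; true; false; _∧_)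
open import Data.Fin using (Fin) renaming (zero to f0; suc to fs)
open import Data.Vec using (Vec; []; _∷_; lookup)
open import Data.List using (List; []; _∷_; [_]; map; concatMap; allFin; length; filterᵇ; foldr)
open import Data.Product using (_×_; _,_; Σ; ∃)
open import Data.Sum using (_⊎_)
open import Data.Integer using (+_)
open import Data.Rational using (ℚ; 0ℚ; 1ℚ; _-_; _*_; _≤_; _<_) renaming (_/_ to _÷ℚ_)
open import Relation.Binary.PropositionalEquality using (_≡_; _≢_)
open import Relation.Nullary using (¬_)

-- A digraph on vertex set Fin k, given by its (duplicate-free) list of edges.
record Digraph (k : ℕ) : Set where
  field
    edges : List (Fin k × Fin k)
open Digraph public

e : ∀ {k} → Digraph k → ℕ
e D = length (edges D)

record Tournament (n : ℕ) : Set where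
  field
    adj     : Fin n → Fin n → Bool
    irrefl  : ∀ i → adj i i ≡ false
    antisym : ∀ i j → adj i j ≡ true → adj j i ≡ false
    total   : ∀ i j → i ≢ j → (adj i j ≡ true) ⊎ (adj j i ≡ true)
open Tournament public

-- all maps Fin k → Fin n, represented as vectors (φ x = lookup φ x)
allMaps : (k n : ℕ) → List (Vec (Fin n) k)
allMaps zero    n = [ [] ]
allMaps (suc k) n = concatMap (λ i → map (i ∷_) (allMaps k n)) (allFin n)

isHom : ∀ {k n} → Digraph k → Tournament n → Vec (Fin n) k → Bool
isHom D T φ = foldr (λ xy b → adj T (lookup φ (Data.Product.proj₁ xy)) (lookup φ (Data.Product.proj₂ xy)) ∧ b) true (edges D)

hom : ∀ {k n} → Digraph k → Tournament n → ℕ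
hom {k} {n} D T = length (filterᵇ (isHom D T) (allMaps k n))

-- t_D(T) = h_D(T) / v(T)^{v(D)}  (set to 0 for the empty tournament)
tD : ∀ {k n} → Digraph k → Tournament n → ℚ
tD {k} {zero}  D T = 0ℚ
tD {k} {suc m} D T = (+ hom D T) ÷ℚ (suc m ^ k) where instance _ = m^n≢0 (suc m) k

twoPowNeg : ℕ → ℚ
twoPowNeg m = (+ 1) ÷ℚ (2 ^ m) where instance _ = m^n≢0 2 m

-- D is tournament Sidorenko: t_D(T) ≥ (1 - o(1)) 2^{-e(D)}, i.e.
-- for every rational ε > 0 there is N such that every tournament T on n ≥ N
-- vertices satisfies t_D(T) ≥ (1 - ε) 2^{-e(D)}.
TournamentSidorenko : ∀ {k} → Digraph k → Set
TournamentSidorenko D =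
  ∀ (ε : ℚ) → 0ℚ < ε → ∃ λ (N : ℕ) → ∀ (n : ℕ) → n ≥ N → (T : Tournament n) →
    (1ℚ - ε) * twoPowNeg (e D) ≤ tD D T

D₂ : Digraph 4
D₂ = record { edges = (a , v₁) ∷ (v₁ , b) ∷ (a , v₂) ∷ (v₂ , b) ∷ [] }
  where
  a b v₁ v₂ : Fin 4
  a = f0
  b = fs f0
  v₁ = fs (fs f0)
  v₂ = fs (fs (fs f0))

-- Let P(a,b) be the number of 2-paths a → v → b in T, so that hom(D₂,T) = Σ_{a,b} P(a,b)².
-- Pairing (a,b) with (b,a), 2(P(a,b)² + P(b,a)²) = (P(a,b) + P(b,a))² + (P(a,b) − P(b,a))².
-- In a tournament P(a,b) − P(b,a) = d⁺(a) − d⁺(b) + ε with ε ∈ {−1,0,1},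
-- Σ_{a,b} P(a,b) = Σ_v d⁻(v) d⁺(v) and Σ_v d⁺(v) = n(n−1)/2. Bounding the first square
-- below by its tangent at n/2 and the second by (d⁺(a) − d⁺(b))² − 2n, the terms Σ_v d⁺(v)²
-- cancel after summation, leaving 16 hom(D₂,T) ≥ n⁴ − 12n³ + 2n², i.e. t_{D₂}(T) ≥ (1 − 12/n)/16.
module Submission where

open import Defs
open import Data.Bool using (Bool; true; false; _∧_)
open import Data.Bool.Properties using (T?)
open import Data.Fin using (Fin; zero; suc)
open import Data.Fin.Properties using (_≟_)
open import Data.List as List using (List; []; _∷_; map; concatMap; tabulate; length; filterᵇ)
open import Data.List.Properties using (length-++; filter-++)
open import Data.Vec using (Vec) renaming ([] to []ᵥ; _∷_ to _∷ᵥ_)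
open import Data.Nat as ℕ using (ℕ; zero; suc; NonZero; z≤n; s≤s)
import Data.Nat.Properties as ℕP
open import Data.Integer as ℤ using (ℤ; +_; +[1+_]; -[1+_]; _+_; _*_; -_; _-_; _≤_; 0ℤ; +≤+; +<+)
import Data.Integer.Properties as ℤP
open import Data.Integer.Tactic.RingSolver using (solve-∀)
open import Algebra.Properties.Semiring.Sum ℤP.+-*-semiring
  using (sum-syntax; sum-cong-≗; ∑-distrib-+; ∑-comm; *-distribˡ-sum; *-distribʳ-sum)
open import Data.Rational as ℚ using (ℚ; mkℚ; 1ℚ; toℚᵘ; ↥_; ↧_; *<*)
import Data.Rational.Properties as ℚP
open import Data.Rational.Unnormalised as ℚᵘ using (mkℚᵘ; *≤*; 1ℚᵘ)
import Data.Rational.Unnormalised.Properties as ℚᵘP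
open import Data.Product using (_,_)
open import Data.Sum using (inj₁; inj₂)
open import Function using (_∘_; id)
open import Relation.Nullary using (does; yes; no)
open import Relation.Binary.PropositionalEquality

∑-const : ∀ n c → ∑[ i < n ] c ≡ + n * c
∑-const zero    c = sym (ℤP.*-zeroˡ c)
∑-const (suc n) c = trans (cong (_+_ c) (∑-const n c)) (sym (ℤP.suc-* (+ n) c))

∑-one : ∀ n → ∑[ i < n ] (+ 1) ≡ + n
∑-one n = trans (∑-const n (+ 1)) (ℤP.*-identityʳ (+ n))

∑-neg : ∀ {n} (f : Fin n → ℤ) → ∑[ i < n ] (- f i) ≡ - ∑[ i < n ] f i
∑-neg {zero}  f = refl
∑-neg {suc n} f = trans (cong (_+_ (- f zero)) (∑-neg (f ∘ suc))) (sym (ℤP.neg-distrib-+ (f zero) _))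

∑-distrib-- : ∀ {n} (f g : Fin n → ℤ) → ∑[ i < n ] (f i - g i) ≡ ∑[ i < n ] f i - ∑[ i < n ] g i
∑-distrib-- f g = trans (∑-distrib-+ f (-_ ∘ g)) (cong (_+_ (∑[ i < _ ] f i)) (∑-neg g))

∑-mono-≤ : ∀ {n} {f g : Fin n → ℤ} → (∀ i → f i ≤ g i) → ∑[ i < n ] f i ≤ ∑[ i < n ] g i
∑-mono-≤ {zero}  f≤g = ℤP.≤-refl
∑-mono-≤ {suc n} f≤g = ℤP.+-mono-≤ (f≤g zero) (∑-mono-≤ (f≤g ∘ suc))

∑-affine : ∀ {n} α β c (f g : Fin n → ℤ) →
  ∑[ i < n ] (α * f i + β * g i - c) ≡ α * ∑[ i < n ] f i + β * ∑[ i < n ] g i - + n * c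
∑-affine {n} α β c f g = begin
  ∑[ i < n ] (α * f i + β * g i - c)
    ≡⟨ ∑-distrib-- (λ i → α * f i + β * g i) (λ _ → c) ⟩
  ∑[ i < n ] (α * f i + β * g i) - ∑[ i < n ] c
    ≡⟨ cong (_- ∑[ i < n ] c) (∑-distrib-+ (λ i → α * f i) (λ i → β * g i)) ⟩
  ∑[ i < n ] (α * f i) + ∑[ i < n ] (β * g i) - ∑[ i < n ] c
    ≡⟨ cong₂ _-_ (sym (cong₂ _+_ (*-distribˡ-sum α f) (*-distribˡ-sum β g))) (∑-const n c) ⟩
  α * ∑[ i < n ] f i + β * ∑[ i < n ] g i - + n * c ∎
  where open ≡-Reasoning

∑∑-* : ∀ {m n} (f : Fin m → ℤ) (g : Fin n → ℤ) →
  ∑[ i < m ] ∑[ j < n ] (f i * g j) ≡ ∑[ i < m ] f i * ∑[ j < n ] g j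
∑∑-* {m} {n} f g = begin
  ∑[ i < m ] ∑[ j < n ] (f i * g j) ≡⟨ sum-cong-≗ (λ i → *-distribˡ-sum (f i) g) ⟨
  ∑[ i < m ] (f i * ∑[ j < n ] g j) ≡⟨ *-distribʳ-sum (∑[ j < n ] g j) f ⟨
  ∑[ i < m ] f i * ∑[ j < n ] g j   ∎
  where open ≡-Reasoning

∑∑-*ˡ : ∀ {m n} c (f : Fin m → Fin n → ℤ) →
  ∑[ i < m ] ∑[ j < n ] (c * f i j) ≡ c * ∑[ i < m ] ∑[ j < n ] f i j
∑∑-*ˡ {m} {n} c f =
  trans (sum-cong-≗ (λ i → sym (*-distribˡ-sum c (f i)))) (sym (*-distribˡ-sum c (λ i → ∑[ j < n ] f i j)))

∑∑-transpose-+ : ∀ {n} (f : Fin n → Fin n → ℤ) →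
  ∑[ i < n ] ∑[ j < n ] (f i j + f j i) ≡ ∑[ i < n ] ∑[ j < n ] f i j + ∑[ i < n ] ∑[ j < n ] f i j
∑∑-transpose-+ {n} f = begin
  ∑[ i < n ] ∑[ j < n ] (f i j + f j i)
    ≡⟨ sum-cong-≗ (λ i → ∑-distrib-+ (f i) (λ j → f j i)) ⟩
  ∑[ i < n ] (∑[ j < n ] f i j + ∑[ j < n ] f j i)
    ≡⟨ ∑-distrib-+ (λ i → ∑[ j < n ] f i j) (λ i → ∑[ j < n ] f j i) ⟩
  ∑[ i < n ] ∑[ j < n ] f i j + ∑[ i < n ] ∑[ j < n ] f j i
    ≡⟨ cong (_+_ (∑[ i < n ] ∑[ j < n ] f i j)) (∑-comm (λ i j → f j i)) ⟩
  ∑[ i < n ] ∑[ j < n ] f i j + ∑[ i < n ] ∑[ j < n ] f i j ∎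
  where open ≡-Reasoning

∑∑-square-diff : ∀ {n} (f : Fin n → ℤ) →
  ∑[ i < n ] ∑[ j < n ] ((f i - f j) * (f i - f j)) ≡
  + 2 * (+ n * ∑[ i < n ] (f i * f i) - ∑[ i < n ] f i * ∑[ i < n ] f i)
∑∑-square-diff {n} f = begin
  ∑[ i < n ] ∑[ j < n ] ((f i - f j) * (f i - f j))
    ≡⟨ sum-cong-≗ (λ i → sum-cong-≗ (λ j → expand (f i) (f j))) ⟩
  ∑[ i < n ] ∑[ j < n ] ((f i * f i + f j * f j) - + 2 * f i * f j)
    ≡⟨ sum-cong-≗ inner ⟩
  ∑[ i < n ] ((+ n * (f i * f i) + S₂) - + 2 * f i * S)
    ≡⟨ ∑-distrib-- (λ i → + n * (f i * f i) + S₂) (λ i → + 2 * f i * S) ⟩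
  ∑[ i < n ] (+ n * (f i * f i) + S₂) - ∑[ i < n ] (+ 2 * f i * S)
    ≡⟨ cong₂ _-_ (trans (∑-distrib-+ (λ i → + n * (f i * f i)) (λ _ → S₂))
                        (cong₂ _+_ (sym (*-distribˡ-sum (+ n) (λ i → f i * f i))) (∑-const n S₂)))
                 (trans (sym (*-distribʳ-sum S (λ i → + 2 * f i)))
                        (cong (_* S) (sym (*-distribˡ-sum (+ 2) f)))) ⟩
  (+ n * S₂ + + n * S₂) - + 2 * S * S
    ≡⟨ collect (+ n) S₂ S ⟩
  + 2 * (+ n * S₂ - S * S) ∎
  where
  open ≡-Reasoning
  S S₂ : ℤ
  S  = ∑[ i < n ] f i
  S₂ = ∑[ i < n ] (f i * f i)
  expand : ∀ x y → (x - y) * (x - y) ≡ (x * x + y * y) - + 2 * x * y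
  expand = solve-∀
  collect : ∀ m s₂ s → (m * s₂ + m * s₂) - + 2 * s * s ≡ + 2 * (m * s₂ - s * s)
  collect = solve-∀
  inner : ∀ i → ∑[ j < n ] ((f i * f i + f j * f j) - + 2 * f i * f j) ≡
                (+ n * (f i * f i) + S₂) - + 2 * f i * S
  inner i = trans (∑-distrib-- (λ j → f i * f i + f j * f j) (λ j → + 2 * f i * f j))
                  (cong₂ _-_ (trans (∑-distrib-+ (λ _ → f i * f i) (λ j → f j * f j))
                                    (cong (_+ S₂) (∑-const n (f i * f i))))
                             (sym (*-distribˡ-sum (+ 2 * f i) f)))

𝟙 : Bool → ℤ
𝟙 true  = + 1
𝟙 false = + 0

𝟙-∧ : ∀ x y → 𝟙 (x ∧ y) ≡ 𝟙 x * 𝟙 y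
𝟙-∧ true  y = sym (ℤP.*-identityˡ (𝟙 y))
𝟙-∧ false y = refl

δ : ∀ {n} → Fin n → Fin n → ℤ
δ i j = 𝟙 (does (i ≟ j))

∑-δ : ∀ {n} (i : Fin n) (f : Fin n → ℤ) → ∑[ j < n ] (δ i j * f j) ≡ f i
∑-δ {suc n} zero f = begin
  + 1 * f zero + ∑[ j < n ] (+ 0 * f (suc j))
    ≡⟨ cong₂ _+_ (ℤP.*-identityˡ (f zero)) (sym (*-distribˡ-sum (+ 0) (f ∘ suc))) ⟩
  f zero + + 0 * ∑[ j < n ] f (suc j)
    ≡⟨ cong (_+_ (f zero)) (ℤP.*-zeroˡ (∑[ j < n ] f (suc j))) ⟩
  f zero + + 0
    ≡⟨ ℤP.+-identityʳ (f zero) ⟩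
  f zero ∎
  where open ≡-Reasoning
∑-δ {suc n} (suc i) f = begin
  + 0 * f zero + ∑[ j < n ] (δ i j * f (suc j)) ≡⟨ cong₂ _+_ (ℤP.*-zeroˡ (f zero)) (∑-δ i (f ∘ suc)) ⟩
  + 0 + f (suc i)                               ≡⟨ ℤP.+-identityˡ (f (suc i)) ⟩
  f (suc i)                                     ∎
  where open ≡-Reasoning

count : ∀ {A : Set} → (A → Bool) → List A → ℕ
count p xs = length (filterᵇ p xs)

count-map : ∀ {A B : Set} (p : B → Bool) (g : A → B) xs → count p (map g xs) ≡ count (p ∘ g) xs
count-map p g []       = refl
count-map p g (x ∷ xs) with p (g x)
... | true  = cong suc (count-map p g xs)
... | false = count-map p g xs

count-concatMap-tabulate : ∀ {A B : Set} (p : B → Bool) (F : A → List B) {n} (h : Fin n → A) →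
  + count p (concatMap F (tabulate h)) ≡ ∑[ i < n ] (+ count p (F (h i)))
count-concatMap-tabulate p F {zero}  h = refl
count-concatMap-tabulate p F {suc n} h = begin
  + count p (F (h zero) List.++ concatMap F (tabulate (h ∘ suc)))
    ≡⟨ cong (+_ ∘ length) (filter-++ (T? ∘ p) (F (h zero)) _) ⟩
  + length (filterᵇ p (F (h zero)) List.++ filterᵇ p (concatMap F (tabulate (h ∘ suc))))
    ≡⟨ cong +_ (length-++ (filterᵇ p (F (h zero)))) ⟩
  + (count p (F (h zero)) ℕ.+ count p (concatMap F (tabulate (h ∘ suc))))
    ≡⟨ ℤP.pos-+ (count p (F (h zero))) _ ⟩
  + count p (F (h zero)) + + count p (concatMap F (tabulate (h ∘ suc)))
    ≡⟨ cong (_+_ (+ count p (F (h zero)))) (count-concatMap-tabulate p F (h ∘ suc)) ⟩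
  ∑[ i < suc n ] (+ count p (F (h i))) ∎
  where open ≡-Reasoning

count-allMaps-suc : ∀ k n (p : Vec (Fin n) (suc k) → Bool) →
  + count p (allMaps (suc k) n) ≡ ∑[ i < n ] (+ count (p ∘ (i ∷ᵥ_)) (allMaps k n))
count-allMaps-suc k n p = trans (count-concatMap-tabulate p (λ i → map (i ∷ᵥ_) (allMaps k n)) id)
  (sum-cong-≗ (λ i → cong +_ (count-map p (i ∷ᵥ_) (allMaps k n))))

count-allMaps-zero : ∀ n (p : Vec (Fin n) zero → Bool) → + count p (allMaps zero n) ≡ 𝟙 (p []ᵥ)
count-allMaps-zero n p with p []ᵥ
... | true  = refl
... | false = refl

toℚᵘ-/ : ∀ i d .{{_ : NonZero d}} → toℚᵘ (i ℚ./ d) ℚᵘ.≃ i ℚᵘ./ d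
toℚᵘ-/ i (suc d) = ℚP.toℚᵘ-fromℚᵘ (mkℚᵘ i d)

one-minus-*-≤-/ : ∀ (ε : ℚ) M N .{{_ : NonZero M}} .{{_ : NonZero N}} (h : ℤ) →
  (↧ ε - ↥ ε) * + N ≤ h * (↧ ε * + M) →
  (1ℚ ℚ.- ε) ℚ.* (+ 1 ℚ./ M) ℚ.≤ h ℚ./ N
one-minus-*-≤-/ ε@(mkℚ P q' _) M N h le = ℚP.toℚᵘ-cancel-≤
  (ℚᵘP.≤-respˡ-≃ (ℚᵘP.≃-sym lhs≃) (ℚᵘP.≤-respʳ-≃ (ℚᵘP.≃-sym (toℚᵘ-/ h N)) (cross M N le)))
  where
  lhs≃ : toℚᵘ ((1ℚ ℚ.- ε) ℚ.* (+ 1 ℚ./ M)) ℚᵘ.≃ (1ℚᵘ ℚᵘ.- mkℚᵘ P q') ℚᵘ.* (+ 1 ℚᵘ./ M)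
  lhs≃ = ℚᵘP.≃-trans (ℚP.toℚᵘ-homo-* (1ℚ ℚ.- ε) _)
    (ℚᵘP.*-cong (ℚᵘP.≃-trans (ℚP.toℚᵘ-homo-+ 1ℚ (ℚ.- ε)) (ℚᵘP.+-congʳ 1ℚᵘ (ℚP.toℚᵘ-homo‿- ε)))
                 (toℚᵘ-/ (+ 1) M))
  cross : ∀ M N .{{_ : NonZero M}} .{{_ : NonZero N}} →
    (+ suc q' - P) * + N ≤ h * (+ suc q' * + M) →
    (1ℚᵘ ℚᵘ.- mkℚᵘ P q') ℚᵘ.* (+ 1 ℚᵘ./ M) ℚᵘ.≤ h ℚᵘ./ N
  cross (suc M) (suc N) le = *≤* (subst₂ _≤_
    (cong (_* + suc N) (unfold-1- (+ suc q') P))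
    (cong (λ d → h * (d * + suc M)) (sym (ℤP.*-identityˡ (+ suc q')))) le)
    where
    -- the numerator of 1 − P/Q as ℚᵘ._+_ and ℚᵘ._*_ compute it
    unfold-1- : ∀ Q P → Q - P ≡ (+ 1 * Q + (- P) * + 1) * + 1
    unfold-1- = solve-∀

linear-error-absorbed : ∀ {a b c n q} → n ℕ.* b ℕ.≤ a ℕ.+ c ℕ.* b → c ℕ.* suc q ℕ.≤ n →
  q ℕ.* (n ℕ.* b) ℕ.≤ suc q ℕ.* a
linear-error-absorbed {a} {b} {c} {n} {q} bound cQ≤n = ℕP.+-cancelʳ-≤ (n ℕ.* b) _ _ (begin
  q ℕ.* (n ℕ.* b) ℕ.+ n ℕ.* b        ≡⟨ ℕP.+-comm (q ℕ.* (n ℕ.* b)) (n ℕ.* b) ⟩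
  suc q ℕ.* (n ℕ.* b)                ≤⟨ ℕP.*-monoʳ-≤ (suc q) bound ⟩
  suc q ℕ.* (a ℕ.+ c ℕ.* b)          ≡⟨ ℕP.*-distribˡ-+ (suc q) a (c ℕ.* b) ⟩
  suc q ℕ.* a ℕ.+ suc q ℕ.* (c ℕ.* b) ≤⟨ ℕP.+-monoʳ-≤ (suc q ℕ.* a) error≤ ⟩
  suc q ℕ.* a ℕ.+ n ℕ.* b            ∎)
  where
  open ℕP.≤-Reasoning
  error≤ : suc q ℕ.* (c ℕ.* b) ℕ.≤ n ℕ.* b
  error≤ = begin
    suc q ℕ.* (c ℕ.* b)  ≡⟨ sym (ℕP.*-assoc (suc q) c b) ⟩
    suc q ℕ.* c ℕ.* b    ≡⟨ cong (ℕ._* b) (ℕP.*-comm (suc q) c) ⟩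
    c ℕ.* suc q ℕ.* b    ≤⟨ ℕP.*-monoˡ-≤ b cQ≤n ⟩
    n ℕ.* b              ∎

sidorenko-of-linear-error : ∀ {k} (D : Digraph (suc k)) (c : ℕ) →
  (∀ {n} (T : Tournament n) → n ℕ.^ suc k ℕ.≤ 2 ℕ.^ e D ℕ.* hom D T ℕ.+ c ℕ.* n ℕ.^ k) →
  TournamentSidorenko D
sidorenko-of-linear-error D c bound (mkℚ (+ zero) _ _) (*<* (+<+ ()))
sidorenko-of-linear-error D c bound (mkℚ -[1+ _ ] _ _) (*<* ())
sidorenko-of-linear-error {k} D c bound ε@(mkℚ +[1+ p ] q _) _ = suc (c ℕ.* suc q) , large
  where
  -- ε = (p + 1)/(q + 1) ≥ 1/(q + 1), so once n ≥ c (q + 1) the error term c/n is at most ε.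
  large : ∀ n → n ℕ.≥ suc (c ℕ.* suc q) → (T : Tournament n) →
          (1ℚ ℚ.- ε) ℚ.* twoPowNeg (e D) ℚ.≤ tD D T
  large (suc m) (s≤s cQ≤m) T =
    one-minus-*-≤-/ ε M nᵛ {{ℕP.m^n≢0 2 (e D)}} {{ℕP.m^n≢0 (suc m) (suc k)}} (+ h) (begin
      (+ suc q - +[1+ p ]) * + nᵛ  ≤⟨ ℤP.*-monoʳ-≤-nonNeg (+ nᵛ) Q-P≤q ⟩
      + q * + nᵛ                   ≡⟨ ℤP.pos-* q nᵛ ⟨
      + (q ℕ.* nᵛ)                 ≤⟨ +≤+ (linear-error-absorbed {b = suc m ℕ.^ k} {c} {suc m} {q} (bound T)
                                                                 (ℕP.m≤n⇒m≤1+n cQ≤m)) ⟩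
      + (suc q ℕ.* (M ℕ.* h))      ≡⟨ cong +_ (ℕP.*-assoc (suc q) M h) ⟨
      + (suc q ℕ.* M ℕ.* h)        ≡⟨ cong +_ (ℕP.*-comm (suc q ℕ.* M) h) ⟩
      + (h ℕ.* (suc q ℕ.* M))      ≡⟨ ℤP.pos-* h (suc q ℕ.* M) ⟩
      + h * + (suc q ℕ.* M)        ≡⟨ cong (_*_ (+ h)) (ℤP.pos-* (suc q) M) ⟩
      + h * (+ suc q * + M)        ∎)
    where
    open ℤP.≤-Reasoning
    h M nᵛ : ℕ
    h = hom D T
    M = 2 ℕ.^ e D
    nᵛ = suc m ℕ.^ suc k
    Q-P≤q : + suc q - +[1+ p ] ≤ + q
    Q-P≤q = subst (_≤ + q) (sym (ℤP.[1+m]⊖[1+n]≡m⊖n q p)) (ℤP.m⊖n≤m q p)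

square-nonNeg : ∀ x → 0ℤ ≤ x * x
square-nonNeg (+ zero) = ℤP.≤-refl
square-nonNeg +[1+ _ ] = +≤+ z≤n
square-nonNeg -[1+ _ ] = +≤+ z≤n

pair-square-bound : ∀ {p q t ε m} → p - q ≡ t + ε → 0ℤ ≤ t * ε + m →
  + 4 * m * (p + q) + + 4 * (t * t) - (m * m + + 8 * m) ≤ + 8 * (p * p + q * q)
pair-square-bound {p} {q} {t} {ε} {m} p-q≡t+ε 0≤tε+m = begin
  L
    ≤⟨ ℤP.i≤i+j L slack {{ℤ.nonNegative slack-nonNeg}} ⟩
  L + slack
    ≡⟨ complete-squares (p + q) t ε m ⟨
  + 4 * ((p + q) * (p + q)) + + 4 * ((t + ε) * (t + ε))
    ≡⟨ cong (λ d → + 4 * ((p + q) * (p + q)) + + 4 * (d * d)) p-q≡t+ε ⟨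
  + 4 * ((p + q) * (p + q)) + + 4 * ((p - q) * (p - q))
    ≡⟨ parallelogram p q ⟩
  + 8 * (p * p + q * q) ∎
  where
  open ℤP.≤-Reasoning
  L slack : ℤ
  L = + 4 * m * (p + q) + + 4 * (t * t) - (m * m + + 8 * m)
  slack = (+ 2 * (p + q) - m) * (+ 2 * (p + q) - m) + + 8 * (t * ε + m) + + 4 * (ε * ε)
  slack-nonNeg : 0ℤ ≤ slack
  slack-nonNeg = ℤP.+-mono-≤ (ℤP.+-mono-≤ (square-nonNeg (+ 2 * (p + q) - m))
                                          (ℤP.*-monoˡ-≤-nonNeg (+ 8) 0≤tε+m))
                             (ℤP.*-monoˡ-≤-nonNeg (+ 4) (square-nonNeg ε))
  complete-squares : ∀ s t ε m →
    + 4 * (s * s) + + 4 * ((t + ε) * (t + ε)) ≡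
    (+ 4 * m * s + + 4 * (t * t) - (m * m + + 8 * m))
      + ((+ 2 * s - m) * (+ 2 * s - m) + + 8 * (t * ε + m) + + 4 * (ε * ε))
  complete-squares = solve-∀
  parallelogram : ∀ p q → + 4 * ((p + q) * (p + q)) + + 4 * ((p - q) * (p - q)) ≡ + 8 * (p * p + q * q)
  parallelogram = solve-∀

sign-bound : ∀ {u w m} (x y : Bool) → 0ℤ ≤ u → u ≤ m → 0ℤ ≤ w → w ≤ m →
             0ℤ ≤ (u - w) * (𝟙 x - 𝟙 y) + m
sign-bound {u} {w} {m} x y 0≤u u≤m 0≤w w≤m = by-cases x y
  where
  plus : ∀ u w m → (u - w) * + 1 + m ≡ u + (m - w)
  plus = solve-∀
  minus : ∀ u w m → (u - w) * ℤ.-1ℤ + m ≡ w + (m - u)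
  minus = solve-∀
  zero-sign : 0ℤ ≤ (u - w) * + 0 + m
  zero-sign = subst (0ℤ ≤_) (sym (trans (cong (_+ m) (ℤP.*-zeroʳ (u - w))) (ℤP.+-identityˡ m)))
                    (ℤP.≤-trans 0≤u u≤m)
  by-cases : ∀ x y → 0ℤ ≤ (u - w) * (𝟙 x - 𝟙 y) + m
  by-cases true  false = subst (0ℤ ≤_) (sym (plus u w m)) (ℤP.+-mono-≤ 0≤u (ℤP.i≤j⇒0≤j-i w≤m))
  by-cases false true  = subst (0ℤ ≤_) (sym (minus u w m)) (ℤP.+-mono-≤ 0≤w (ℤP.i≤j⇒0≤j-i u≤m))
  by-cases true  true  = zero-sign
  by-cases false false = zero-sign

module _ {n} (T : Tournament n) where

  arc : Fin n → Fin n → ℤ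
  arc a v = 𝟙 (adj T a v)

  outdeg : Fin n → ℤ
  outdeg a = ∑[ v < n ] arc a v

  paths₂ : Fin n → Fin n → ℤ
  paths₂ a b = ∑[ v < n ] (arc a v * arc v b)

  arc-converse : ∀ a v → arc v a ≡ + 1 - arc a v - δ a v
  arc-converse a v with a ≟ v
  ... | yes refl rewrite irrefl T a = refl
  ... | no a≢v with total T a v a≢v
  ...   | inj₁ a→v rewrite a→v | antisym T a v a→v = refl
  ...   | inj₂ v→a rewrite v→a | antisym T v a v→a = refl

  arc-nonNeg : ∀ a v → 0ℤ ≤ arc a v
  arc-nonNeg a v with adj T a v
  ... | true  = +≤+ z≤n
  ... | false = +≤+ z≤n

  arc≤1 : ∀ a v → arc a v ≤ + 1
  arc≤1 a v with adj T a v
  ... | true  = ℤP.≤-refl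
  ... | false = +≤+ z≤n

  outdeg-nonNeg : ∀ a → 0ℤ ≤ outdeg a
  outdeg-nonNeg a =
    subst (_≤ outdeg a) (trans (∑-const n 0ℤ) (ℤP.*-zeroʳ (+ n))) (∑-mono-≤ (arc-nonNeg a))

  outdeg≤n : ∀ a → outdeg a ≤ + n
  outdeg≤n a = subst (outdeg a ≤_) (∑-one n) (∑-mono-≤ (arc≤1 a))

  indeg-complement : ∀ v → ∑[ a < n ] arc a v ≡ + n - + 1 - outdeg v
  indeg-complement v = begin
    ∑[ a < n ] arc a v                             ≡⟨ sum-cong-≗ (arc-converse v) ⟩
    ∑[ a < n ] (+ 1 - arc v a - δ v a)             ≡⟨ ∑-distrib-- (λ a → + 1 - arc v a) (δ v) ⟩
    ∑[ a < n ] (+ 1 - arc v a) - ∑[ a < n ] δ v a  ≡⟨ cong₂ _-_ (∑-distrib-- (λ _ → + 1) (arc v)) ∑δ≡1 ⟩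
    ∑[ a < n ] (+ 1) - outdeg v - + 1              ≡⟨ cong (λ s → s - outdeg v - + 1) (∑-one n) ⟩
    + n - outdeg v - + 1                           ≡⟨ swap (+ n) (outdeg v) ⟩
    + n - + 1 - outdeg v                           ∎
    where
    open ≡-Reasoning
    ∑δ≡1 : ∑[ a < n ] δ v a ≡ + 1
    ∑δ≡1 = trans (sum-cong-≗ (λ a → sym (ℤP.*-identityʳ (δ v a)))) (∑-δ v (λ _ → + 1))
    swap : ∀ m d → m - d - + 1 ≡ m - + 1 - d
    swap = solve-∀

  ∑-outdeg : + 2 * ∑[ a < n ] outdeg a ≡ + n * (+ n - + 1)
  ∑-outdeg = half (sym (begin
    + n * (+ n - + 1) - X                    ≡⟨ cong (_- X) (∑-const n (+ n - + 1)) ⟨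
    ∑[ v < n ] (+ n - + 1) - X               ≡⟨ ∑-distrib-- (λ _ → + n - + 1) outdeg ⟨
    ∑[ v < n ] (+ n - + 1 - outdeg v)        ≡⟨ sum-cong-≗ indeg-complement ⟨
    ∑[ v < n ] ∑[ a < n ] arc a v            ≡⟨ ∑-comm arc ⟨
    X                                        ∎))
    where
    open ≡-Reasoning
    X = ∑[ a < n ] outdeg a
    half : ∀ {x s} → x ≡ s - x → + 2 * x ≡ s
    half {x} {s} x≡s-x = trans (double x) (trans (cong (_+_ x) x≡s-x) (cancel x s))
      where
      double : ∀ x → + 2 * x ≡ x + x
      double = solve-∀
      cancel : ∀ x s → x + (s - x) ≡ s
      cancel = solve-∀

  ∑∑-paths₂ : ∑[ a < n ] ∑[ b < n ] paths₂ a b ≡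
              (+ n - + 1) * ∑[ v < n ] outdeg v - ∑[ v < n ] (outdeg v * outdeg v)
  ∑∑-paths₂ = begin
    ∑[ a < n ] ∑[ b < n ] ∑[ v < n ] (arc a v * arc v b)
      ≡⟨ sum-cong-≗ (λ a → ∑-comm (λ b v → arc a v * arc v b)) ⟩
    ∑[ a < n ] ∑[ v < n ] ∑[ b < n ] (arc a v * arc v b)
      ≡⟨ sum-cong-≗ (λ a → sum-cong-≗ (λ v → *-distribˡ-sum (arc a v) (arc v))) ⟨
    ∑[ a < n ] ∑[ v < n ] (arc a v * outdeg v)
      ≡⟨ ∑-comm (λ a v → arc a v * outdeg v) ⟩
    ∑[ v < n ] ∑[ a < n ] (arc a v * outdeg v)
      ≡⟨ sum-cong-≗ (λ v → *-distribʳ-sum (outdeg v) (λ a → arc a v)) ⟨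
    ∑[ v < n ] (∑[ a < n ] arc a v * outdeg v)
      ≡⟨ sum-cong-≗ (λ v → cong (_* outdeg v) (indeg-complement v)) ⟩
    ∑[ v < n ] ((+ n - + 1 - outdeg v) * outdeg v)
      ≡⟨ sum-cong-≗ (λ v → expand (+ n - + 1) (outdeg v)) ⟩
    ∑[ v < n ] ((+ n - + 1) * outdeg v - outdeg v * outdeg v)
      ≡⟨ ∑-distrib-- (λ v → (+ n - + 1) * outdeg v) (λ v → outdeg v * outdeg v) ⟩
    ∑[ v < n ] ((+ n - + 1) * outdeg v) - ∑[ v < n ] (outdeg v * outdeg v)
      ≡⟨ cong (_- ∑[ v < n ] (outdeg v * outdeg v)) (*-distribˡ-sum (+ n - + 1) outdeg) ⟨
    (+ n - + 1) * ∑[ v < n ] outdeg v - ∑[ v < n ] (outdeg v * outdeg v) ∎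
    where
    open ≡-Reasoning
    expand : ∀ c x → (c - x) * x ≡ c * x - x * x
    expand = solve-∀

  paths₂-skew : ∀ a b → paths₂ a b - paths₂ b a ≡ (outdeg a - outdeg b) + (arc b a - arc a b)
  paths₂-skew a b = begin
    paths₂ a b - paths₂ b a
      ≡⟨ ∑-distrib-- (λ v → arc a v * arc v b) (λ v → arc b v * arc v a) ⟨
    ∑[ v < n ] (arc a v * arc v b - arc b v * arc v a)
      ≡⟨ sum-cong-≗ (λ v → cong₂ (λ x y → arc a v * x - arc b v * y)
                                 (arc-converse b v) (arc-converse a v)) ⟩
    ∑[ v < n ] (arc a v * (+ 1 - arc b v - δ b v) - arc b v * (+ 1 - arc a v - δ a v))
      ≡⟨ sum-cong-≗ (λ v → regroup (arc a v) (arc b v) (δ a v) (δ b v)) ⟩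
    ∑[ v < n ] ((arc a v - arc b v) + (δ a v * arc b v - δ b v * arc a v))
      ≡⟨ ∑-distrib-+ (λ v → arc a v - arc b v) (λ v → δ a v * arc b v - δ b v * arc a v) ⟩
    ∑[ v < n ] (arc a v - arc b v) + ∑[ v < n ] (δ a v * arc b v - δ b v * arc a v)
      ≡⟨ cong₂ _+_ (∑-distrib-- (arc a) (arc b))
                   (trans (∑-distrib-- (λ v → δ a v * arc b v) (λ v → δ b v * arc a v))
                          (cong₂ _-_ (∑-δ a (arc b)) (∑-δ b (arc a)))) ⟩
    (outdeg a - outdeg b) + (arc b a - arc a b) ∎
    where
    open ≡-Reasoning
    regroup : ∀ x y p q → x * (+ 1 - y - q) - y * (+ 1 - x - p) ≡ (x - y) + (p * y - q * x)
    regroup = solve-∀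

  hom-D₂ : + hom D₂ T ≡ ∑[ a < n ] ∑[ b < n ] (paths₂ a b * paths₂ a b)
  hom-D₂ = begin
    + hom D₂ T
      ≡⟨ expand-maps ⟩
    ∑[ a < n ] ∑[ b < n ] ∑[ v < n ] ∑[ w < n ] 𝟙 (isHom D₂ T (a ∷ᵥ b ∷ᵥ v ∷ᵥ w ∷ᵥ []ᵥ))
      ≡⟨ sum-cong-≗ (λ a → sum-cong-≗ (λ b → sum-cong-≗ (λ v → sum-cong-≗ (λ w →
           𝟙-∧⁴ (adj T a v) (adj T v b) (adj T a w) (adj T w b))))) ⟩
    ∑[ a < n ] ∑[ b < n ] ∑[ v < n ] ∑[ w < n ] ((arc a v * arc v b) * (arc a w * arc w b))
      ≡⟨ sum-cong-≗ (λ a → sum-cong-≗ (λ b →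
           ∑∑-* (λ v → arc a v * arc v b) (λ w → arc a w * arc w b))) ⟩
    ∑[ a < n ] ∑[ b < n ] (paths₂ a b * paths₂ a b) ∎
    where
    open ≡-Reasoning
    expand-maps :
      + hom D₂ T ≡ ∑[ a < n ] ∑[ b < n ] ∑[ v < n ] ∑[ w < n ] 𝟙 (isHom D₂ T (a ∷ᵥ b ∷ᵥ v ∷ᵥ w ∷ᵥ []ᵥ))
    expand-maps =
      trans (count-allMaps-suc 3 n (isHom D₂ T)) (sum-cong-≗ λ a →
      trans (count-allMaps-suc 2 n (λ φ → isHom D₂ T (a ∷ᵥ φ))) (sum-cong-≗ λ b →
      trans (count-allMaps-suc 1 n (λ φ → isHom D₂ T (a ∷ᵥ b ∷ᵥ φ))) (sum-cong-≗ λ v →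
      trans (count-allMaps-suc 0 n (λ φ → isHom D₂ T (a ∷ᵥ b ∷ᵥ v ∷ᵥ φ))) (sum-cong-≗ λ w →
      count-allMaps-zero n (λ φ → isHom D₂ T (a ∷ᵥ b ∷ᵥ v ∷ᵥ w ∷ᵥ φ))))))
    𝟙-∧⁴ : ∀ x y z w → 𝟙 (x ∧ (y ∧ (z ∧ (w ∧ true)))) ≡ (𝟙 x * 𝟙 y) * (𝟙 z * 𝟙 w)
    𝟙-∧⁴ x y z w = begin
      𝟙 (x ∧ (y ∧ (z ∧ (w ∧ true))))
        ≡⟨ 𝟙-∧ x _ ⟩
      𝟙 x * 𝟙 (y ∧ (z ∧ (w ∧ true)))
        ≡⟨ cong (λ r → 𝟙 x * r) (𝟙-∧ y _) ⟩
      𝟙 x * (𝟙 y * 𝟙 (z ∧ (w ∧ true)))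
        ≡⟨ cong (λ r → 𝟙 x * (𝟙 y * r)) (𝟙-∧ z _) ⟩
      𝟙 x * (𝟙 y * (𝟙 z * 𝟙 (w ∧ true)))
        ≡⟨ cong (λ r → 𝟙 x * (𝟙 y * (𝟙 z * r))) (𝟙-∧ w true) ⟩
      𝟙 x * (𝟙 y * (𝟙 z * (𝟙 w * + 1)))
        ≡⟨ reassoc (𝟙 x) (𝟙 y) (𝟙 z) (𝟙 w) ⟩
      (𝟙 x * 𝟙 y) * (𝟙 z * 𝟙 w) ∎
      where
      reassoc : ∀ x y z w → x * (y * (z * (w * + 1))) ≡ (x * y) * (z * w)
      reassoc = solve-∀

  ∑∑paths₂² : ℤ
  ∑∑paths₂² = ∑[ a < n ] ∑[ b < n ] (paths₂ a b * paths₂ a b)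

  pair-lower : Fin n → Fin n → ℤ
  pair-lower a b = + 4 * + n * (paths₂ a b + paths₂ b a)
                 + + 4 * ((outdeg a - outdeg b) * (outdeg a - outdeg b)) - (+ n * + n + + 8 * + n)

  pair-lower≤ : ∀ a b → pair-lower a b ≤ + 8 * (paths₂ a b * paths₂ a b + paths₂ b a * paths₂ b a)
  pair-lower≤ a b =
    pair-square-bound {paths₂ a b} {paths₂ b a} {outdeg a - outdeg b} {arc b a - arc a b} {+ n}
      (paths₂-skew a b)
      (sign-bound (adj T b a) (adj T a b) (outdeg-nonNeg a) (outdeg≤n a) (outdeg-nonNeg b) (outdeg≤n b))

  ∑∑-pair-lower : ∑[ a < n ] ∑[ b < n ] pair-lower a b ≡
                  + n * + n * + n * + n - + 12 * (+ n * + n * + n) + + 2 * (+ n * + n)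
  ∑∑-pair-lower = begin
    ∑[ a < n ] ∑[ b < n ] pair-lower a b
      ≡⟨ trans (sum-cong-≗ (λ a → ∑-affine (+ 4 * m) (+ 4) C (λ b → paths₂ a b + paths₂ b a)
                                                             (λ b → Δ a b * Δ a b)))
               (∑-affine (+ 4 * m) (+ 4) (m * C) (λ a → ∑[ b < n ] (paths₂ a b + paths₂ b a))
                                                 (λ a → ∑[ b < n ] (Δ a b * Δ a b))) ⟩
    + 4 * m * ∑[ a < n ] ∑[ b < n ] (paths₂ a b + paths₂ b a)
      + + 4 * ∑[ a < n ] ∑[ b < n ] (Δ a b * Δ a b) - m * (m * C)
      ≡⟨ cong₂ (λ z s → + 4 * m * z + + 4 * s - m * (m * C))
               (trans (∑∑-transpose-+ paths₂) (cong (λ z → z + z) ∑∑-paths₂))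
               (∑∑-square-diff outdeg) ⟩
    + 4 * m * (((m - + 1) * X - Y) + ((m - + 1) * X - Y)) + + 4 * (+ 2 * (m * Y - X * X)) - m * (m * C)
      ≡⟨ eliminate-Y m X Y ⟩
    F (+ 2 * X)
      ≡⟨ cong F ∑-outdeg ⟩
    F (m * (m - + 1))
      ≡⟨ expand-F m ⟩
    m * m * m * m - + 12 * (m * m * m) + + 2 * (m * m) ∎
    where
    open ≡-Reasoning
    m X Y C : ℤ
    m = + n
    X = ∑[ v < n ] outdeg v
    Y = ∑[ v < n ] (outdeg v * outdeg v)
    C = m * m + + 8 * m
    Δ : Fin n → Fin n → ℤ
    Δ a b = outdeg a - outdeg b
    F : ℤ → ℤ
    F x = + 4 * m * (m - + 1) * x - + 2 * (x * x) - (m * m * m * m + + 8 * (m * m * m))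
    eliminate-Y : ∀ m x y →
      + 4 * m * (((m - + 1) * x - y) + ((m - + 1) * x - y)) + + 4 * (+ 2 * (m * y - x * x)) - m * (m * (m * m + + 8 * m))
      ≡ + 4 * m * (m - + 1) * (+ 2 * x) - + 2 * ((+ 2 * x) * (+ 2 * x)) - (m * m * m * m + + 8 * (m * m * m))
    eliminate-Y = solve-∀
    expand-F : ∀ m →
      + 4 * m * (m - + 1) * (m * (m - + 1)) - + 2 * ((m * (m - + 1)) * (m * (m - + 1))) - (m * m * m * m + + 8 * (m * m * m))
      ≡ m * m * m * m - + 12 * (m * m * m) + + 2 * (m * m)
    expand-F = solve-∀

  ∑∑paths₂²-bound : + n * + n * + n * + n - + 12 * (+ n * + n * + n) + + 2 * (+ n * + n) ≤ + 16 * ∑∑paths₂²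
  ∑∑paths₂²-bound = begin
    + n * + n * + n * + n - + 12 * (+ n * + n * + n) + + 2 * (+ n * + n)
      ≡⟨ ∑∑-pair-lower ⟨
    ∑[ a < n ] ∑[ b < n ] pair-lower a b
      ≤⟨ ∑-mono-≤ (λ a → ∑-mono-≤ (pair-lower≤ a)) ⟩
    ∑[ a < n ] ∑[ b < n ] (+ 8 * (paths₂ a b * paths₂ a b + paths₂ b a * paths₂ b a))
      ≡⟨ ∑∑-*ˡ (+ 8) (λ a b → paths₂ a b * paths₂ a b + paths₂ b a * paths₂ b a) ⟩
    + 8 * ∑[ a < n ] ∑[ b < n ] (paths₂ a b * paths₂ a b + paths₂ b a * paths₂ b a)
      ≡⟨ cong (_*_ (+ 8)) (∑∑-transpose-+ (λ a b → paths₂ a b * paths₂ a b)) ⟩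
    + 8 * (∑∑paths₂² + ∑∑paths₂²)
      ≡⟨ double-8 ∑∑paths₂² ⟩
    + 16 * ∑∑paths₂² ∎
    where
    open ℤP.≤-Reasoning
    double-8 : ∀ h → + 8 * (h + h) ≡ + 16 * h
    double-8 = solve-∀

pos-^ : ∀ m k → + (m ℕ.^ k) ≡ (+ m) ℤ.^ k
pos-^ m zero    = refl
pos-^ m (suc k) = trans (ℤP.pos-* m (m ℕ.^ k)) (cong (_*_ (+ m)) (pos-^ m k))

D₂-error-bound : ∀ {n} (T : Tournament n) → n ℕ.^ 4 ℕ.≤ 2 ℕ.^ e D₂ ℕ.* hom D₂ T ℕ.+ 12 ℕ.* n ℕ.^ 3
D₂-error-bound {n} T = ℤP.drop‿+≤+ (begin
  + (n ℕ.^ 4)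
    ≡⟨ trans (pos-^ n 4) (fourth m) ⟩
  m * m * m * m
    ≤⟨ ℤP.i≤i+j (m * m * m * m) (+ 2 * (m * m)) {{ℤ.nonNegative (ℤP.*-monoˡ-≤-nonNeg (+ 2) (square-nonNeg m))}} ⟩
  m * m * m * m + + 2 * (m * m)
    ≡⟨ shift m ⟩
  m * m * m * m - + 12 * (m * m * m) + + 2 * (m * m) + + 12 * (m * m * m)
    ≤⟨ ℤP.+-monoˡ-≤ (+ 12 * (m * m * m)) (∑∑paths₂²-bound T) ⟩
  + 16 * ∑∑paths₂² T + + 12 * (m * m * m)
    ≡⟨ casts ⟨
  + (2 ℕ.^ e D₂ ℕ.* hom D₂ T ℕ.+ 12 ℕ.* n ℕ.^ 3) ∎)
  where
  open ℤP.≤-Reasoning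
  m : ℤ
  m = + n
  fourth : ∀ m → m * (m * (m * (m * + 1))) ≡ m * m * m * m
  fourth = solve-∀
  cube : ∀ m → m * (m * (m * + 1)) ≡ m * m * m
  cube = solve-∀
  shift : ∀ m → m * m * m * m + + 2 * (m * m) ≡
                m * m * m * m - + 12 * (m * m * m) + + 2 * (m * m) + + 12 * (m * m * m)
  shift = solve-∀
  casts : + (16 ℕ.* hom D₂ T ℕ.+ 12 ℕ.* n ℕ.^ 3) ≡ + 16 * ∑∑paths₂² T + + 12 * (m * m * m)
  casts = trans (ℤP.pos-+ (16 ℕ.* hom D₂ T) (12 ℕ.* n ℕ.^ 3)) (cong₂ _+_
    (trans (ℤP.pos-* 16 (hom D₂ T)) (cong (_*_ (+ 16)) (hom-D₂ T)))
    (trans (ℤP.pos-* 12 (n ℕ.^ 3)) (cong (_*_ (+ 12)) (trans (pos-^ n 3) (cube m)))))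

lemma4p10 : TournamentSidorenko D₂
lemma4p10 = sidorenko-of-linear-error D₂ 12 D₂-error-bound
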